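{- For polarized structures $\Gamma,\Delta$, the following are equivalent in any phase model: $[\![{\uparrow}\Gamma^+]\!]^-\subseteq[\![\Delta^-]\!]^-$; $[\![{\uparrow}\Delta^+]\!]^-\subseteq[\![\Gamma^-]\!]^-$; $[\![{\downarrow}\Delta^-]\!]^+\subseteq[\![\Gamma^+]\!]^+$; $[\![{\downarrow}\Gamma^-]\!]^+\subseteq[\![\Delta^+]\!]^+$.
   Context: Notation: $\otimes$ tensor, $\oplus$ par, $/,\backslash$ implications, $\oslash$ right coimplication, $\ominus$ left coimplication (circled slash / circled backslash in the source). Polarized formulas: $P,Q ::= p\mid P\otimes Q\mid P\oslash N\mid N\ominus P\mid P\lor Q\mid{\downarrow}N$, $N,M ::= \bar p\mid M\oplus N\mid Q\backslash M\mid M/Q\mid M\land N\mid{\uparrow}P$, with linear negation $p^\bot=\bar p$, $\bar p^\bot=p$, $(P\otimes Q)^\bot=Q^\bot\oplus P^\bot$, $(M\oplus N)^\bot=N^\bot\otimes M^\bot$, $(N\ominus P)^\bot=P^\bot/N^\bot$, $(M/Q)^\bot=Q^\bot\ominus M^\bot$, $(P\oslash N)^\bot=N^\bot\backslash P^\bot$, $(Q\backslash M)^\bot=M^\bot\oslash Q^\bot$, $(P\lor Q)^\bot=Q^\bot\land P^\bot$, $(M\land N)^\bot=N^\bot\lor M^\bot$, $({\downarrow}N)^\bot={\uparrow}N^\bot$, $({\uparrow}P)^\bot={\downarrow}P^\bot$. Polarized structures $\Gamma ::= P\mid\Gamma\mathbin{\cdot\otimes\cdot}\Delta\mid\Gamma\mathbin{\cdot\oslash\cdot}\Delta\mid\Delta\mathbin{\cdot\ominus\cdot}\Gamma$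 with $P^+=P$, $P^-=P^\bot$, $(\Gamma\mathbin{\cdot\otimes\cdot}\Delta)^+=\Gamma^+\otimes\Delta^+$, $(\Gamma\mathbin{\cdot\otimes\cdot}\Delta)^-=\Delta^-\oplus\Gamma^-$, $(\Delta\mathbin{\cdot\ominus\cdot}\Gamma)^+=\Delta^-\ominus\Gamma^+$, $(\Delta\mathbin{\cdot\ominus\cdot}\Gamma)^-=\Gamma^-/\Delta^+$, $(\Gamma\mathbin{\cdot\oslash\cdot}\Delta)^+=\Gamma^+\oslash\Delta^-$, $(\Gamma\mathbin{\cdot\oslash\cdot}\Delta)^-=\Delta^+\backslash\Gamma^-$ (so $\Gamma^+$ is positive, $\Gamma^-$ negative, and $\Gamma^{+\bot}=\Gamma^-$). Phase space: nonempty set $P$ with binary operations $\cdot\otimes\cdot,\cdot\oslash\cdot,\cdot\ominus\cdot$ and $\bot\subseteq P\times P$ with $\langle x,y\rangle\in\bot\Rightarrow\langle y,x\rangle\in\bot$, $\langle x\mathbin{\cdot\otimes\cdot}y,z\rangle\in\bot\Leftrightarrow\langle x,y\mathbin{\cdot\ominus\cdot}z\rangle\in\bot$, $\langle x,y\mathbin{\cdot\otimes\cdot}z\rangle\in\bot\Leftrightarrow\langle x\mathbin{\cdot\oslash\cdot}y,z\rangle\in\bot$; $A^\bot=\{x\mid\forall y\in A,\ \langle x,y\rangle\in\bot\}$; facts: $A=A^{\bot\bot}$. Model: valuation $v$ of atoms into facts, extended by $[\![p]\!]^+=v(p)$, $[\![\bar p]\!]^-=v(p)$, $[\![P\otimes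 Q]\!]^+=[\![P]\!]^+\times[\![Q]\!]^+$, $[\![M\oplus N]\!]^-=[\![N]\!]^-\times[\![M]\!]^-$, $[\![P\oslash N]\!]^+=[\![P]\!]^+\leftarrow[\![N]\!]^-$, $[\![M/Q]\!]^-=[\![Q]\!]^+\rightarrow[\![M]\!]^-$, $[\![N\ominus P]\!]^+=[\![N]\!]^-\rightarrow[\![P]\!]^+$, $[\![Q\backslash M]\!]^-=[\![M]\!]^-\rightarrow[\![Q]\!]^+$, $[\![P\lor Q]\!]^+=[\![P]\!]^+\cap[\![Q]\!]^+$, $[\![M\land N]\!]^-=[\![M]\!]^-\cap[\![N]\!]^-$, $[\![{\downarrow}N]\!]^+=([\![N]\!]^-)^\bot$, $[\![{\uparrow}P]\!]^-=([\![P]\!]^+)^\bot$, where $A\times B=\{x\mathbin{\cdot\otimes\cdot}y\mid x\in A^\bot,y\in B^\bot\}^\bot$, $A\leftarrow B=\{x\mathbin{\cdot\oslash\cdot}y\mid x\in A^\bot,y\in B^\bot\}^\bot$, $A\rightarrow B=\{x\mathbin{\cdot\ominus\cdot}y\mid x\in A^\bot,y\in B^\bot\}^\bot$. Facts used: $(\cdot)^\bot$ is a Galois connection, $[\![P]\!]^+=[\![P^\bot]\!]^-$, $[\![N]\!]^-=[\![N^\bot]\!]^+$, $[\![P]\!]^+=([\![{\uparrow}P]\!]^-)^\bot$, $[\![N]\!]^-=([\![{\downarrow}N]\!]^+)^\bot$. -}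

module Defs where

open import Level using (Level; _⊔_; suc; 0ℓ)
open import Data.Product using (Σ; _×_; _,_; ∃-syntax)
open import Relation.Binary.PropositionalEquality using (_≡_)

module Formulas (Atom : Set) where
  mutual
    data Pos : Set where
      atom : Atom → Pos
      _⊗_  : Pos → Pos → Pos
      _⊘_  : Pos → Neg → Pos
      _⊖_  : Neg → Pos → Pos
      _∨_  : Pos → Pos → Pos
      ↓    : Neg → Pos
    data Neg : Set where
      natom : Atom → Neg
      _⊕_  : Neg → Neg → Neg            -- M ⊕ N   (par)
      _⧹_  : Pos → Neg → Neg
      _⧸_  : Neg → Pos → Neg
      _∧_  : Neg → Neg → Neg
      ↑    : Pos → Neg

  mutual
    _⊥⁺ : Pos → Neg
    atom p ⊥⁺ = natom p
    (P ⊗ Q) ⊥⁺ = (Q ⊥⁺) ⊕ (P ⊥⁺)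
    (P ⊘ N) ⊥⁺ = (N ⊥⁻) ⧹ (P ⊥⁺)
    (N ⊖ P) ⊥⁺ = (P ⊥⁺) ⧸ (N ⊥⁻)
    (P ∨ Q) ⊥⁺ = (Q ⊥⁺) ∧ (P ⊥⁺)
    ↓ N ⊥⁺ = ↑ (N ⊥⁻)

    _⊥⁻ : Neg → Pos
    natom p ⊥⁻ = atom p
    (M ⊕ N) ⊥⁻ = (N ⊥⁻) ⊗ (M ⊥⁻)
    (Q ⧹ M) ⊥⁻ = (M ⊥⁻) ⊘ (Q ⊥⁺)
    (M ⧸ Q) ⊥⁻ = (Q ⊥⁺) ⊖ (M ⊥⁻)
    (M ∧ N) ⊥⁻ = (N ⊥⁻) ∨ (M ⊥⁻)
    ↑ P ⊥⁻ = ↓ (P ⊥⁺)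

  data Str : Set where
    leaf  : Pos → Str
    _·⊗·_ : Str → Str → Str
    _·⊘·_ : Str → Str → Str
    _·⊖·_ : Str → Str → Str

  mutual
    _⁺ : Str → Pos
    leaf P ⁺ = P
    (Γ ·⊗· Δ) ⁺ = (Γ ⁺) ⊗ (Δ ⁺)
    (Δ ·⊖· Γ) ⁺ = (Δ ⁻) ⊖ (Γ ⁺)
    (Γ ·⊘· Δ) ⁺ = (Γ ⁺) ⊘ (Δ ⁻)

    _⁻ : Str → Neg
    leaf P ⁻ = P ⊥⁺
    (Γ ·⊗· Δ) ⁻ = (Δ ⁻) ⊕ (Γ ⁻)
    (Δ ·⊖· Γ) ⁻ = (Γ ⁻) ⧸ (Δ ⁺)
    (Γ ·⊘· Δ) ⁻ = (Δ ⁺) ⧹ (Γ ⁻)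

record PhaseSpace (ℓ ℓ' : Level) : Set (suc (ℓ ⊔ ℓ')) where
  field
    Carrier : Set ℓ
    inhabited : Carrier
    _·⊗·_ _·⊘·_ _·⊖·_ : Carrier → Carrier → Carrier
    _⊥_ : Carrier → Carrier → Set ℓ'
    ⊥-sym : ∀ {x y} → x ⊥ y → y ⊥ x
    ⊥-⊗⊖ : ∀ {x y z} → ((x ·⊗· y) ⊥ z → x ⊥ (y ·⊖· z)) × (x ⊥ (y ·⊖· z) → (x ·⊗· y) ⊥ z)
    ⊥-⊗⊘ : ∀ {x y z} → (x ⊥ (y ·⊗· z) → (x ·⊘· y) ⊥ z) × ((x ·⊘· y) ⊥ z → x ⊥ (y ·⊗· z))

  Subset : Set (suc (ℓ ⊔ ℓ'))
  Subset = Carrier → Set (ℓ ⊔ ℓ')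

  _⊆_ : Subset → Subset → Set (ℓ ⊔ ℓ')
  A ⊆ B = ∀ x → A x → B x

  _ᗮ : Subset → Subset
  (A ᗮ) x = ∀ y → A y → x ⊥ y

  IsFact : Subset → Set (ℓ ⊔ ℓ')
  IsFact A = (A ⊆ ((A ᗮ) ᗮ)) × (((A ᗮ) ᗮ) ⊆ A)

  lift : (Carrier → Carrier → Carrier) → Subset → Subset → Subset
  lift _op_ A B = (λ z → ∃[ x ] ∃[ y ] ((A ᗮ) x × (B ᗮ) y × z ≡ (x op y))) ᗮ

  _×ᶠ_ _←ᶠ_ _→ᶠ_ : Subset → Subset → Subset
  A ×ᶠ B = lift _·⊗·_ A B
  A ←ᶠ B = lift _·⊘·_ A B
  A →ᶠ B = lift _·⊖·_ A B

  _∩_ : Subset → Subset → Subset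
  (A ∩ B) x = A x × B x

  module Interp {Atom : Set} (v : Atom → Subset) where
    open Formulas Atom
    mutual
      ⟦_⟧⁺ : Pos → Subset
      ⟦ atom p ⟧⁺ = v p
      ⟦ P ⊗ Q ⟧⁺ = ⟦ P ⟧⁺ ×ᶠ ⟦ Q ⟧⁺
      ⟦ P ⊘ N ⟧⁺ = ⟦ P ⟧⁺ ←ᶠ ⟦ N ⟧⁻
      ⟦ N ⊖ P ⟧⁺ = ⟦ N ⟧⁻ →ᶠ ⟦ P ⟧⁺
      ⟦ P ∨ Q ⟧⁺ = ⟦ P ⟧⁺ ∩ ⟦ Q ⟧⁺
      ⟦ ↓ N ⟧⁺ = ⟦ N ⟧⁻ ᗮ

      ⟦_⟧⁻ : Neg → Subset
      ⟦ natom p ⟧⁻ = v p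
      ⟦ M ⊕ N ⟧⁻ = ⟦ N ⟧⁻ ×ᶠ ⟦ M ⟧⁻
      ⟦ M ⧸ Q ⟧⁻ = ⟦ Q ⟧⁺ →ᶠ ⟦ M ⟧⁻
      ⟦ Q ⧹ M ⟧⁻ = ⟦ M ⟧⁻ ←ᶠ ⟦ Q ⟧⁺
      ⟦ M ∧ N ⟧⁻ = ⟦ M ⟧⁻ ∩ ⟦ N ⟧⁻
      ⟦ ↑ P ⟧⁻ = ⟦ P ⟧⁺ ᗮ

module _ {ℓ ℓ'} (S : PhaseSpace ℓ ℓ') {Atom : Set} (v : Atom → PhaseSpace.Subset S) where
  open PhaseSpace S
  open Formulas Atom
  open Interp v

  cond1 cond2 cond3 cond4 : Formulas.Str Atom → Formulas.Str Atom → Set (ℓ ⊔ ℓ')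
  cond1 Γ Δ = ⟦ ↑ (Γ ⁺) ⟧⁻ ⊆ ⟦ Δ ⁻ ⟧⁻
  cond2 Γ Δ = ⟦ ↑ (Δ ⁺) ⟧⁻ ⊆ ⟦ Γ ⁻ ⟧⁻
  cond3 Γ Δ = ⟦ ↓ (Δ ⁻) ⟧⁺ ⊆ ⟦ Γ ⁺ ⟧⁺
  cond4 Γ Δ = ⟦ ↓ (Γ ⁻) ⟧⁺ ⊆ ⟦ Δ ⁺ ⟧⁺

  IsValuation : Set (ℓ ⊔ ℓ')
  IsValuation = ∀ p → IsFact (v p)

-- In a phase model every interpreted formula is closed (A^⊥⊥ ⊆ A), so for closed A and B
-- the inclusions A^⊥ ⊆ B and B^⊥ ⊆ A are equivalent. This swaps condition 1 with 3.
-- Moreover ⟦Γ⁺⟧⁺ and ⟦Γ⁻⟧⁻ are the same set, because ⟦ P ⟧⁺ = ⟦ P ⊥⁺ ⟧⁻ for every formula;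
-- rewriting with it turns condition 1 into 4 and condition 3 into 2.
module Submission where

open import Defs
open import Data.Product using (_×_; _,_; proj₁; proj₂)
open import Function.Bundles using (_⇔_; mk⇔)
open import Function.Construct.Composition using (_⇔-∘_)
open import Level using (_⊔_)

module PhaseSpaceProperties {ℓ ℓ'} (S : PhaseSpace ℓ ℓ') where
  open PhaseSpace S

  infix 4 _≐_
  _≐_ : Subset → Subset → Set (ℓ ⊔ ℓ')
  A ≐ B = (A ⊆ B) × (B ⊆ A)

  ≐-refl : ∀ {A} → A ≐ A
  ≐-refl = (λ _ a → a) , (λ _ a → a)

  ≐-sym : ∀ {A B} → A ≐ B → B ≐ A
  ≐-sym (A⊆B , B⊆A) = B⊆A , A⊆B

  Closed : Subset → Set (ℓ ⊔ ℓ')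
  Closed A = ((A ᗮ) ᗮ) ⊆ A

  ᗮ-antitone : ∀ {A B} → A ⊆ B → (B ᗮ) ⊆ (A ᗮ)
  ᗮ-antitone A⊆B x x⊥B y y∈A = x⊥B y (A⊆B y y∈A)

  ⊆-ᗮᗮ : ∀ {A} → A ⊆ ((A ᗮ) ᗮ)
  ⊆-ᗮᗮ x x∈A y y⊥A = ⊥-sym (y⊥A x x∈A)

  ᗮ-cong : ∀ {A B} → A ≐ B → (A ᗮ) ≐ (B ᗮ)
  ᗮ-cong (A⊆B , B⊆A) = ᗮ-antitone B⊆A , ᗮ-antitone A⊆B

  ᗮ-closed : ∀ {A} → Closed (A ᗮ)
  ᗮ-closed = ᗮ-antitone ⊆-ᗮᗮ

  ∩-closed : ∀ {A B} → Closed A → Closed B → Closed (A ∩ B)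
  ∩-closed closedA closedB x x∈A∩Bᗮᗮ =
    closedA x (ᗮ-antitone (ᗮ-antitone (λ _ → proj₁)) x x∈A∩Bᗮᗮ) ,
    closedB x (ᗮ-antitone (ᗮ-antitone (λ _ → proj₂)) x x∈A∩Bᗮᗮ)

  ∩-comm-cong : ∀ {A B C D} → A ≐ D → B ≐ C → (A ∩ B) ≐ (C ∩ D)
  ∩-comm-cong (A⊆D , D⊆A) (B⊆C , C⊆B) =
    (λ x (a , b) → B⊆C x b , A⊆D x a) , (λ x (c , d) → D⊆A x d , C⊆B x c)

  lift-mono : ∀ op {A A' B B'} → A ⊆ A' → B ⊆ B' → lift op A B ⊆ lift op A' B'
  lift-mono op A⊆A' B⊆B' z z∈lift w (x , y , x⊥A' , y⊥B' , w≡xy) =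
    z∈lift w (x , y , ᗮ-antitone A⊆A' x x⊥A' , ᗮ-antitone B⊆B' y y⊥B' , w≡xy)

  lift-cong : ∀ op {A A' B B'} → A ≐ A' → B ≐ B' → lift op A B ≐ lift op A' B'
  lift-cong op (A⊆A' , A'⊆A) (B⊆B' , B'⊆B) =
    lift-mono op A⊆A' B⊆B' , lift-mono op A'⊆A B'⊆B

  ᗮ⊆-swap : ∀ {A B} → Closed A → Closed B → ((A ᗮ) ⊆ B) ⇔ ((B ᗮ) ⊆ A)
  ᗮ⊆-swap closedA closedB = mk⇔ (contrapose closedA) (contrapose closedB)
    where
    contrapose : ∀ {X Y} → Closed X → (X ᗮ) ⊆ Y → (Y ᗮ) ⊆ X
    contrapose closedX Xᗮ⊆Y x x⊥Y = closedX x (ᗮ-antitone Xᗮ⊆Y x x⊥Y)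

  ᗮ⊆-cong : ∀ {A A' B B'} → A ≐ A' → B ≐ B' → ((A ᗮ) ⊆ B) ⇔ ((A' ᗮ) ⊆ B')
  ᗮ⊆-cong (A⊆A' , A'⊆A) (B⊆B' , B'⊆B) =
    mk⇔ (λ Aᗮ⊆B x x⊥A' → B⊆B' x (Aᗮ⊆B x (ᗮ-antitone A⊆A' x x⊥A')))
        (λ A'ᗮ⊆B' x x⊥A → B'⊆B x (A'ᗮ⊆B' x (ᗮ-antitone A'⊆A x x⊥A)))

module InterpProperties {ℓ ℓ'} (S : PhaseSpace ℓ ℓ') {Atom : Set}
                        (v : Atom → PhaseSpace.Subset S) where
  open PhaseSpace S
  open PhaseSpaceProperties S
  open Formulas Atom
  open Interp v

  mutual
    ⟦⟧⁺-⊥⁺ : ∀ P → ⟦ P ⟧⁺ ≐ ⟦ P ⊥⁺ ⟧⁻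
    ⟦⟧⁺-⊥⁺ (atom p) = ≐-refl
    ⟦⟧⁺-⊥⁺ (P ⊗ Q) = lift-cong _ (⟦⟧⁺-⊥⁺ P) (⟦⟧⁺-⊥⁺ Q)
    ⟦⟧⁺-⊥⁺ (P ⊘ N) = lift-cong _ (⟦⟧⁺-⊥⁺ P) (⟦⟧⁻-⊥⁻ N)
    ⟦⟧⁺-⊥⁺ (N ⊖ P) = lift-cong _ (⟦⟧⁻-⊥⁻ N) (⟦⟧⁺-⊥⁺ P)
    ⟦⟧⁺-⊥⁺ (P ∨ Q) = ∩-comm-cong (⟦⟧⁺-⊥⁺ P) (⟦⟧⁺-⊥⁺ Q)
    ⟦⟧⁺-⊥⁺ (↓ N) = ᗮ-cong (⟦⟧⁻-⊥⁻ N)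

    ⟦⟧⁻-⊥⁻ : ∀ N → ⟦ N ⟧⁻ ≐ ⟦ N ⊥⁻ ⟧⁺
    ⟦⟧⁻-⊥⁻ (natom p) = ≐-refl
    ⟦⟧⁻-⊥⁻ (M ⊕ N) = lift-cong _ (⟦⟧⁻-⊥⁻ N) (⟦⟧⁻-⊥⁻ M)
    ⟦⟧⁻-⊥⁻ (Q ⧹ M) = lift-cong _ (⟦⟧⁻-⊥⁻ M) (⟦⟧⁺-⊥⁺ Q)
    ⟦⟧⁻-⊥⁻ (M ⧸ Q) = lift-cong _ (⟦⟧⁺-⊥⁺ Q) (⟦⟧⁻-⊥⁻ M)
    ⟦⟧⁻-⊥⁻ (M ∧ N) = ∩-comm-cong (⟦⟧⁻-⊥⁻ M) (⟦⟧⁻-⊥⁻ N)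
    ⟦⟧⁻-⊥⁻ (↑ P) = ᗮ-cong (⟦⟧⁺-⊥⁺ P)

  ⟦⁺⟧⁺≐⟦⁻⟧⁻ : ∀ Γ → ⟦ Γ ⁺ ⟧⁺ ≐ ⟦ Γ ⁻ ⟧⁻
  ⟦⁺⟧⁺≐⟦⁻⟧⁻ (leaf P) = ⟦⟧⁺-⊥⁺ P
  ⟦⁺⟧⁺≐⟦⁻⟧⁻ (Γ ·⊗· Δ) = lift-cong _ (⟦⁺⟧⁺≐⟦⁻⟧⁻ Γ) (⟦⁺⟧⁺≐⟦⁻⟧⁻ Δ)
  ⟦⁺⟧⁺≐⟦⁻⟧⁻ (Γ ·⊘· Δ) = lift-cong _ (⟦⁺⟧⁺≐⟦⁻⟧⁻ Γ) (≐-sym (⟦⁺⟧⁺≐⟦⁻⟧⁻ Δ))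
  ⟦⁺⟧⁺≐⟦⁻⟧⁻ (Δ ·⊖· Γ) = lift-cong _ (≐-sym (⟦⁺⟧⁺≐⟦⁻⟧⁻ Δ)) (⟦⁺⟧⁺≐⟦⁻⟧⁻ Γ)

  module _ (isValuation : IsValuation S v) where
    mutual
      ⟦⟧⁺-closed : ∀ P → Closed ⟦ P ⟧⁺
      ⟦⟧⁺-closed (atom p) = proj₂ (isValuation p)
      ⟦⟧⁺-closed (P ⊗ Q) = ᗮ-closed
      ⟦⟧⁺-closed (P ⊘ N) = ᗮ-closed
      ⟦⟧⁺-closed (N ⊖ P) = ᗮ-closed
      ⟦⟧⁺-closed (P ∨ Q) = ∩-closed (⟦⟧⁺-closed P) (⟦⟧⁺-closed Q)
      ⟦⟧⁺-closed (↓ N) = ᗮ-closed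

      ⟦⟧⁻-closed : ∀ N → Closed ⟦ N ⟧⁻
      ⟦⟧⁻-closed (natom p) = proj₂ (isValuation p)
      ⟦⟧⁻-closed (M ⊕ N) = ᗮ-closed
      ⟦⟧⁻-closed (Q ⧹ M) = ᗮ-closed
      ⟦⟧⁻-closed (M ⧸ Q) = ᗮ-closed
      ⟦⟧⁻-closed (M ∧ N) = ∩-closed (⟦⟧⁻-closed M) (⟦⟧⁻-closed N)
      ⟦⟧⁻-closed (↑ P) = ᗮ-closed

lemma49 : ∀ {ℓ ℓ'} (S : PhaseSpace ℓ ℓ') (Atom : Set) (v : Atom → PhaseSpace.Subset S)
    → IsValuation S v
    → (Γ Δ : Formulas.Str Atom)
    → (cond1 S v Γ Δ ⇔ cond2 S v Γ Δ)
    × (cond1 S v Γ Δ ⇔ cond3 S v Γ Δ)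
    × (cond1 S v Γ Δ ⇔ cond4 S v Γ Δ)
lemma49 S Atom v isValuation Γ Δ = 3⇔2 ⇔-∘ 1⇔3 , 1⇔3 , 1⇔4
  where
  open PhaseSpaceProperties S
  open InterpProperties S v
  open Formulas Atom

  1⇔3 : cond1 S v Γ Δ ⇔ cond3 S v Γ Δ
  1⇔3 = ᗮ⊆-swap (⟦⟧⁺-closed isValuation (Γ ⁺)) (⟦⟧⁻-closed isValuation (Δ ⁻))

  3⇔2 : cond3 S v Γ Δ ⇔ cond2 S v Γ Δ
  3⇔2 = ᗮ⊆-cong (≐-sym (⟦⁺⟧⁺≐⟦⁻⟧⁻ Δ)) (⟦⁺⟧⁺≐⟦⁻⟧⁻ Γ)

  1⇔4 : cond1 S v Γ Δ ⇔ cond4 S v Γ Δ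
  1⇔4 = ᗮ⊆-cong (⟦⁺⟧⁺≐⟦⁻⟧⁻ Γ) (≐-sym (⟦⁺⟧⁺≐⟦⁻⟧⁻ Δ))
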